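{- Let $D>0$ be an integer such that $-D$ is a fundamental discriminant, let $p$ be an odd prime, and suppose $4p=U^2+DV^2$ with integers $U,V$. Let $\chi(X)=X^2-UX+p$. Then $\chi(X)$ has a root modulo $8$ (i.e. there is $x\in\mathbb{Z}$ with $\chi(x)\equiv 0\pmod 8$) if and only if one of the following holds: (i) $4\mid D$ and $2\mid V$; (ii) $4\nmid D$ and either $4\mid V$, or ($2\,\|\,V$ and $D\equiv 7\pmod 8$).
   Context: $2\,\|\,V$ means $2\mid V$ and $4\nmid V$. -}

module Defs where

open import Data.Nat using (ℕ; _<_; _%_)
open import Data.Integer as ℤ using (ℤ; +_; -_; _+_; _-_; _*_)
open import Data.Integer.Divisibility using (_∣_)
open import Data.Product using (_×_; ∃-syntax)
open import Data.Sum using (_⊎_)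
open import Relation.Binary.PropositionalEquality using (_≡_)
open import Relation.Nullary using (¬_)

infix 4 _≡_[mod_] _∥_
_≡_[mod_] : ℤ → ℤ → ℤ → Set
a ≡ b [mod m ] = m ∣ (a - b)

SquareFree : ℤ → Set
SquareFree n = ∀ (k : ℕ) → 1 < k → ¬ ((+ k) * (+ k) ∣ n)

FundamentalDiscriminant : ℤ → Set
FundamentalDiscriminant d =
  (d ≡ + 1 [mod + 4 ] × SquareFree d)
  ⊎ (∃[ m ] (d ≡ + 4 * m × (m ≡ + 2 [mod + 4 ] ⊎ m ≡ + 3 [mod + 4 ]) × SquareFree m))

χ : ℤ → ℤ → ℤ → ℤ
χ U p x = x * x - U * x + p

_∥_ : ℤ → ℤ → Set
a ∥ b = a ∣ b × ¬ (a * a ∣ b)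

-- Since 4p = U² + DV², 4χ(x) = (2x - U)² + DV². If D and V are both odd, then so is U, and χ
-- (with p odd) takes only odd values. Otherwise DV² = 4N, with N = D(V/2)² for odd D and N = mV²
-- for D = 4m; then U = 2u is even and χ(x) = (x - u)² + N, so χ has a root modulo 8 iff -N is a
-- square modulo 8. As odd squares are 1 modulo 8, this holds whenever N = E(2W)², because
-- (2EW)² + E(2W)² = 4E(E + 1)W²; it holds for N = D·(odd)² with D odd iff D ≡ 7 (mod 8); and it
-- fails for N = m·(odd)² with m ≡ 1, 2 (mod 4), since squares are 0 or 1 modulo 4.
module Submission where

open import Defs
open import Data.Nat using (ℕ; _>_)
open import Data.Nat.Primality using (Prime)
open import Data.Integer using (ℤ; +_; -_; _+_; _*_)
open import Data.Integer.Divisibility using (_∣_)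
open import Data.Product using (_×_; ∃-syntax)
open import Data.Sum using (_⊎_)
open import Function.Bundles using (_⇔_)
open import Relation.Nullary using (¬_)
open import Relation.Binary.PropositionalEquality using (_≡_)

open import Data.Nat using (suc; NonZero; _<_; s≤s; z<s; s<s)
open import Data.Nat.Divisibility as ℕ using (>⇒∤)
import Data.Nat.Properties as ℕ
open import Data.Integer using (_-_; _%ℕ_; _/ℕ_)
import Data.Integer.Properties as ℤ
open import Data.Integer.DivMod using (n%ℕd<d; a≡a%ℕn+[a/ℕn]*n)
open import Data.Integer.Divisibility.Signed as Signed
  using (divides; ∣ᵤ⇒∣; ∣⇒∣ᵤ; ∣m∣n⇒∣m+n; ∣m⇒∣-m)
open import Data.Integer.Tactic.RingSolver using (solve)
open import Data.List.Base using (_∷_; [])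
open import Data.Empty using (⊥-elim)
open import Data.Product using (_,_)
open import Data.Sum using (inj₁; inj₂)
open import Function.Base using (const; _∘_; _∋_)
open import Function.Bundles using (mk⇔; module Equivalence)
open import Function.Construct.Composition using (_⇔-∘_)
open import Function.Construct.Symmetry using (⇔-sym)
open import Function.Related.TypeIsomorphisms using (¬-cong-⇔)
open import Data.Product.Function.NonDependent.Propositional using (_×-⇔_)
open import Data.Sum.Function.Propositional using (_⊎-⇔_)
open import Level using (0ℓ)
open import Relation.Binary.Bundles using (Setoid)
open import Relation.Binary.PropositionalEquality
  using (refl; sym; trans; cong; subst; module ≡-Reasoning)
import Relation.Binary.Reasoning.Setoid as SetoidReasoning

-- Defs' congruence unfolds to divisibility of absolute values, from which Agda cannot
-- recover a, b and n; this record keeps them as indices.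
infix 4 _≡_⟨mod_⟩
record _≡_⟨mod_⟩ (a b n : ℤ) : Set where
  constructor congruent
  field n∣a-b : n Signed.∣ a - b

by-quotient : ∀ {n a b} q → a - b ≡ q * n → a ≡ b ⟨mod n ⟩
by-quotient q eq = congruent (divides q eq)

congruent-via : ∀ {n a b} x → n Signed.∣ x → x ≡ a - b → a ≡ b ⟨mod n ⟩
congruent-via x n∣x refl = congruent n∣x

mod-reflexive : ∀ {n a b} → a ≡ b → a ≡ b ⟨mod n ⟩
mod-reflexive {n} {a} refl = by-quotient (+ 0) (solve (a ∷ n ∷ []))

mod-refl : ∀ {n a} → a ≡ a ⟨mod n ⟩
mod-refl = mod-reflexive refl

mod-sym : ∀ {n a b} → a ≡ b ⟨mod n ⟩ → b ≡ a ⟨mod n ⟩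
mod-sym {a = a} {b} (congruent p) =
  congruent-via (- (a - b)) (∣m⇒∣-m p) (solve (a ∷ b ∷ []))

mod-trans : ∀ {n a b c} → a ≡ b ⟨mod n ⟩ → b ≡ c ⟨mod n ⟩ → a ≡ c ⟨mod n ⟩
mod-trans {a = a} {b} {c} (congruent p) (congruent q) =
  congruent-via ((a - b) + (b - c)) (∣m∣n⇒∣m+n p q) (solve (a ∷ b ∷ c ∷ []))

mod-+-cong : ∀ {n a b c d} → a ≡ b ⟨mod n ⟩ → c ≡ d ⟨mod n ⟩ → a + c ≡ b + d ⟨mod n ⟩
mod-+-cong {a = a} {b} {c} {d} (congruent p) (congruent q) =
  congruent-via ((a - b) + (c - d)) (∣m∣n⇒∣m+n p q) (solve (a ∷ b ∷ c ∷ d ∷ []))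

mod-+-congˡ : ∀ {n b c} a → b ≡ c ⟨mod n ⟩ → a + b ≡ a + c ⟨mod n ⟩
mod-+-congˡ a = mod-+-cong (mod-refl {a = a})

mod-+-congʳ : ∀ {n b c} a → b ≡ c ⟨mod n ⟩ → b + a ≡ c + a ⟨mod n ⟩
mod-+-congʳ a b≡c = mod-+-cong b≡c (mod-refl {a = a})

mod-neg-cong : ∀ {n a b} → a ≡ b ⟨mod n ⟩ → - a ≡ - b ⟨mod n ⟩
mod-neg-cong {a = a} {b} (congruent p) =
  congruent-via (- (a - b)) (∣m⇒∣-m p) (solve (a ∷ b ∷ []))

mod-*-cong : ∀ {n a b c d} → a ≡ b ⟨mod n ⟩ → c ≡ d ⟨mod n ⟩ → a * c ≡ b * d ⟨mod n ⟩
mod-*-cong {a = a} {b} {c} {d} (congruent p) (congruent q) =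
  congruent-via (a * (c - d) + (a - b) * d)
    (∣m∣n⇒∣m+n (Signed.∣n⇒∣m*n a q) (Signed.∣m⇒∣m*n d p)) (solve (a ∷ b ∷ c ∷ d ∷ []))

mod-*-congˡ : ∀ {n b c} a → b ≡ c ⟨mod n ⟩ → a * b ≡ a * c ⟨mod n ⟩
mod-*-congˡ a = mod-*-cong (mod-refl {a = a})

mod-weaken : ∀ {m n a b} → m Signed.∣ n → a ≡ b ⟨mod n ⟩ → a ≡ b ⟨mod m ⟩
mod-weaken m∣n (congruent p) = congruent (Signed.∣-trans m∣n p)

multiple≡0 : ∀ n k → n * k ≡ + 0 ⟨mod n ⟩
multiple≡0 n k = by-quotient k (solve (n ∷ k ∷ []))

2∣4 : + 2 Signed.∣ + 4
2∣4 = divides (+ 2) refl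

2∣8 : + 2 Signed.∣ + 8
2∣8 = divides (+ 4) refl

4∣8 : + 4 Signed.∣ + 8
4∣8 = divides (+ 2) refl

residue≢0 : ∀ {n r} .{{_ : NonZero r}} → r < n → ¬ (+ r ≡ + 0 ⟨mod + n ⟩)
residue≢0 {r = r} r<n (congruent p) = >⇒∤ r<n (subst (_ ℕ.∣_) (ℕ.+-identityʳ r) (∣⇒∣ᵤ p))

[mod]⇔⟨mod⟩ : ∀ n a b → (a ≡ b [mod n ]) ⇔ (a ≡ b ⟨mod n ⟩)
[mod]⇔⟨mod⟩ _ _ _ = mk⇔ (λ p → congruent (∣ᵤ⇒∣ p)) (λ { (congruent p) → ∣⇒∣ᵤ p })

∣⇔≡0 : ∀ n a → (n ∣ a) ⇔ (a ≡ + 0 ⟨mod n ⟩)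
∣⇔≡0 n a = mk⇔
  (λ p → congruent (subst (n Signed.∣_) (sym (ℤ.+-identityʳ a)) (∣ᵤ⇒∣ p)))
  (λ { (congruent p) → ∣⇒∣ᵤ (subst (n Signed.∣_) (ℤ.+-identityʳ a) p) })

mod-setoid : ℤ → Setoid 0ℓ 0ℓ
mod-setoid n = record
  { Carrier       = ℤ
  ; _≈_           = λ a b → a ≡ b ⟨mod n ⟩
  ; isEquivalence = record { refl = mod-refl ; sym = mod-sym ; trans = mod-trans }
  }

module ≡-mod-Reasoning (n : ℤ) = SetoidReasoning (mod-setoid n)

-- Case splits go through this eliminator rather than `with`: with-abstraction normalises the
-- goal, unfolding ℤ multiplication into a form the ring solver cannot read.
by-parity : {P : ℤ → Set} → (∀ k → P (+ 2 * k)) → (∀ k → P (+ 2 * k + + 1)) → ∀ n → P n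
by-parity {P} even odd n with n %ℕ 2 | n /ℕ 2 | n%ℕd<d n 2 | a≡a%ℕn+[a/ℕn]*n n 2
... | 0 | q | _ | refl = subst P ((+ 2 * q ≡ + 0 + q * + 2) ∋ solve (q ∷ [])) (even q)
... | 1 | q | _ | refl = subst P ((+ 2 * q + + 1 ≡ + 1 + q * + 2) ∋ solve (q ∷ [])) (odd q)
... | suc (suc _) | _ | s≤s (s≤s ()) | _

odd≡1 : ∀ k → + 2 * k + + 1 ≡ + 1 ⟨mod + 2 ⟩
odd≡1 k = mod-+-cong (multiple≡0 (+ 2) k) mod-refl

odd≢0 : ∀ k → ¬ (+ 2 * k + + 1 ≡ + 0 ⟨mod + 2 ⟩)
odd≢0 k k≡0 = residue≢0 (s<s z<s) (mod-trans (mod-sym (odd≡1 k)) k≡0)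

2∤⇒≡1 : ∀ a → ¬ (+ 2 ∣ a) → a ≡ + 1 ⟨mod + 2 ⟩
2∤⇒≡1 = by-parity
  (λ k 2∤2k → ⊥-elim (2∤2k (Equivalence.from (∣⇔≡0 (+ 2) (+ 2 * k)) (multiple≡0 (+ 2) k))))
  (λ k _ → odd≡1 k)

-- (2k+1)² - 1 = 4k(k+1), and k(k+1) is even.
odd-square≡1 : ∀ k → (+ 2 * k + + 1) * (+ 2 * k + + 1) ≡ + 1 ⟨mod + 8 ⟩
odd-square≡1 = by-parity
  (λ i → by-quotient (i * (+ 2 * i + + 1)) (solve (i ∷ [])))
  (λ i → by-quotient ((+ 2 * i + + 1) * (i + + 1)) (solve (i ∷ [])))

square≡0∨1-mod-4 : ∀ z → z * z ≡ + 0 ⟨mod + 4 ⟩ ⊎ z * z ≡ + 1 ⟨mod + 4 ⟩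
square≡0∨1-mod-4 = by-parity
  (λ k → inj₁ (by-quotient (k * k) (solve (k ∷ []))))
  (λ k → inj₂ (mod-weaken 4∣8 (odd-square≡1 k)))

4*≡0-mod-2 : ∀ k → + 4 * k ≡ + 0 ⟨mod + 2 ⟩
4*≡0-mod-2 k = mod-weaken 2∣4 (multiple≡0 (+ 4) k)

even-square⇒even : ∀ U → U * U ≡ + 0 ⟨mod + 2 ⟩ → ∃[ u ] U ≡ + 2 * u
even-square⇒even = by-parity
  (λ u _ → u , refl)
  (λ u U²≡0 → ⊥-elim (residue≢0 (s<s z<s)
                        (mod-trans (mod-sym (mod-weaken 2∣8 (odd-square≡1 u))) U²≡0)))

RootMod : ℤ → (ℤ → ℤ) → Set
RootMod n f = ∃[ x ] (f x ≡ + 0 ⟨mod n ⟩)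

∃-root⇔RootMod : ∀ n f → (∃[ x ] (f x ≡ + 0 [mod n ])) ⇔ RootMod n f
∃-root⇔RootMod n f = mk⇔
  (λ (x , fx≡0) → x , Equivalence.to ([mod]⇔⟨mod⟩ n (f x) (+ 0)) fx≡0)
  (λ (x , fx≡0) → x , Equivalence.from ([mod]⇔⟨mod⟩ n (f x) (+ 0)) fx≡0)

RootMod-shift : ∀ {n f g} c → (∀ x → f x ≡ g (x - c)) → RootMod n f ⇔ RootMod n g
RootMod-shift {g = g} c f≡g = mk⇔
  (λ (x , fx≡0) → x - c , mod-trans (mod-reflexive (sym (f≡g x))) fx≡0)
  (λ (z , gz≡0) → z + c ,
                  mod-trans (mod-reflexive (trans (f≡g (z + c)) (cong g (z+c-c≡z z)))) gz≡0)
  where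
  z+c-c≡z : ∀ z → z + c - c ≡ z
  z+c-c≡z z = solve (z ∷ c ∷ [])

χ-complete-square : ∀ {U p N u} → U ≡ + 2 * u → + 4 * p ≡ U * U + + 4 * N →
                    ∀ x → χ U p x ≡ (x - u) * (x - u) + N
χ-complete-square {p = p} {N} {u} refl 4p≡ x = begin
  x * x - + 2 * u * x + p             ≡⟨ cong (λ q → x * x - + 2 * u * x + q) p≡u²+N ⟩
  x * x - + 2 * u * x + (u * u + N)   ≡⟨ solve (x ∷ u ∷ N ∷ []) ⟩
  (x - u) * (x - u) + N               ∎
  where
  open ≡-Reasoning
  p≡u²+N : p ≡ u * u + N
  p≡u²+N = ℤ.*-cancelˡ-≡ (+ 4) p (u * u + N) (trans 4p≡ (solve (u ∷ N ∷ [])))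

RootMod-χ⇔z²+N : ∀ {n} U p N → + 4 * p ≡ U * U + + 4 * N →
                 RootMod n (χ U p) ⇔ RootMod n (λ z → z * z + N)
RootMod-χ⇔z²+N U p N 4p≡ =
  let u , U≡2u = even-square⇒even U U²≡0 in
  RootMod-shift u (χ-complete-square U≡2u 4p≡)
  where
  open ≡-mod-Reasoning (+ 2)
  U²≡0 : U * U ≡ + 0 ⟨mod + 2 ⟩
  U²≡0 = begin
    U * U               ≡⟨ ℤ.+-identityʳ (U * U) ⟨
    U * U + + 0         ≈⟨ mod-+-congˡ (U * U) (4*≡0-mod-2 N) ⟨
    U * U + + 4 * N     ≡⟨ 4p≡ ⟨
    + 4 * p             ≈⟨ 4*≡0-mod-2 p ⟩
    + 0                 ∎

χ-odd : ∀ u p x → p ≡ + 1 ⟨mod + 2 ⟩ → χ (+ 2 * u + + 1) p x ≡ + 1 ⟨mod + 2 ⟩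
χ-odd u p x p≡1 = by-parity
  (λ a → mod-+-cong (mod-+-cong (mod-*-cong (multiple≡0 (+ 2) a) (multiple≡0 (+ 2) a))
                                (mod-neg-cong (mod-*-cong (odd≡1 u) (multiple≡0 (+ 2) a)))) p≡1)
  (λ a → mod-+-cong (mod-+-cong (mod-*-cong (odd≡1 a) (odd≡1 a))
                                (mod-neg-cong (mod-*-cong (odd≡1 u) (odd≡1 a)))) p≡1)
  x

no-RootMod-χ : ∀ {p N} → p ≡ + 1 ⟨mod + 2 ⟩ → N ≡ + 1 ⟨mod + 2 ⟩ →
               ∀ U → + 4 * p ≡ U * U + N → ¬ RootMod (+ 8) (χ U p)
no-RootMod-χ {p} {N} p≡1 N≡1 = by-parity U-even U-odd
  where
  open ≡-mod-Reasoning (+ 2)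
  U-even : ∀ u → + 4 * p ≡ (+ 2 * u) * (+ 2 * u) + N → ¬ RootMod (+ 8) (χ (+ 2 * u) p)
  U-even u 4p≡ _ = residue≢0 (s<s z<s) (begin
    + 0 * + 0 + + 1
      ≈⟨ mod-+-cong (mod-*-cong (multiple≡0 (+ 2) u) (multiple≡0 (+ 2) u)) N≡1 ⟨
    (+ 2 * u) * (+ 2 * u) + N  ≡⟨ 4p≡ ⟨
    + 4 * p                    ≈⟨ 4*≡0-mod-2 p ⟩
    + 0                        ∎)
  U-odd : ∀ u → + 4 * p ≡ (+ 2 * u + + 1) * (+ 2 * u + + 1) + N →
          ¬ RootMod (+ 8) (χ (+ 2 * u + + 1) p)
  U-odd u _ (x , χx≡0) = residue≢0 (s<s z<s)
    (mod-trans (mod-sym (χ-odd u p x p≡1)) (mod-weaken 2∣8 χx≡0))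

z²+E[2W]²-root : ∀ E W → RootMod (+ 8) (λ z → z * z + E * ((+ 2 * W) * (+ 2 * W)))
z²+E[2W]²-root = by-parity
  (λ e W → + 0 , by-quotient (e * (W * W)) (solve (e ∷ W ∷ [])))
  (λ e W → + 2 * (+ 2 * e + + 1) * W ,
           by-quotient ((+ 2 * e + + 1) * (W * W) * (e + + 1)) (solve (e ∷ W ∷ [])))

z²+Dw²-root⇔ : ∀ {D} → D ≡ + 1 ⟨mod + 2 ⟩ → ∀ i →
  RootMod (+ 8) (λ z → z * z + D * ((+ 2 * i + + 1) * (+ 2 * i + + 1))) ⇔ (D ≡ + 7 ⟨mod + 8 ⟩)
z²+Dw²-root⇔ {D} D≡1 i = mk⇔ (λ (z , root) → D≡7 z root) (λ D≡7 → + 1 , root-at-1 D≡7)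
  where
  w : ℤ
  w = + 2 * i + + 1
  D≡7 : ∀ z → z * z + D * (w * w) ≡ + 0 ⟨mod + 8 ⟩ → D ≡ + 7 ⟨mod + 8 ⟩
  D≡7 = by-parity
    (λ a root → ⊥-elim (residue≢0 (s<s z<s)
      let open ≡-mod-Reasoning (+ 2) in begin
        + 0 * + 0 + + 1 * + 1
          ≈⟨ mod-+-cong (mod-*-cong (multiple≡0 (+ 2) a) (multiple≡0 (+ 2) a))
                        (mod-*-cong D≡1 (mod-weaken 2∣8 (odd-square≡1 i))) ⟨
        (+ 2 * a) * (+ 2 * a) + D * (w * w)   ≈⟨ mod-weaken 2∣8 root ⟩
        + 0                                   ∎))
    (λ a root → let open ≡-mod-Reasoning (+ 8) in begin
      D                                                  ≡⟨ solve (D ∷ []) ⟩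
      + 1 + D * + 1 + - + 1
        ≈⟨ mod-+-congʳ (- + 1) (mod-+-cong (odd-square≡1 a) (mod-*-congˡ D (odd-square≡1 i))) ⟨
      (+ 2 * a + + 1) * (+ 2 * a + + 1) + D * (w * w) + - + 1   ≈⟨ mod-+-congʳ (- + 1) root ⟩
      + 0 + - + 1                                        ≈⟨ by-quotient (- + 1) refl ⟩
      + 7                                                ∎)
  root-at-1 : D ≡ + 7 ⟨mod + 8 ⟩ → + 1 * + 1 + D * (w * w) ≡ + 0 ⟨mod + 8 ⟩
  root-at-1 D≡7 = mod-trans (mod-+-congˡ (+ 1 * + 1) (mod-*-cong D≡7 (odd-square≡1 i)))
                            (multiple≡0 (+ 8) (+ 1))

z²+mw²-no-root : ∀ {m} → m ≡ + 1 ⟨mod + 4 ⟩ ⊎ m ≡ + 2 ⟨mod + 4 ⟩ →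
  ∀ j → ¬ RootMod (+ 8) (λ z → z * z + m * ((+ 2 * j + + 1) * (+ 2 * j + + 1)))
z²+mw²-no-root {m} m≡1∨2 j (z , root) = s+r≢0 (square≡0∨1-mod-4 z) m≡1∨2 (begin
  z * z + m
    ≡⟨ cong (λ t → z * z + t) (ℤ.*-identityʳ m) ⟨
  z * z + m * + 1
    ≈⟨ mod-+-congˡ (z * z) (mod-*-congˡ m (mod-weaken 4∣8 (odd-square≡1 j))) ⟨
  z * z + m * ((+ 2 * j + + 1) * (+ 2 * j + + 1))
    ≈⟨ mod-weaken 4∣8 root ⟩
  + 0 ∎)
  where
  open ≡-mod-Reasoning (+ 4)
  s+r≢0 : ∀ {s r} → s ≡ + 0 ⟨mod + 4 ⟩ ⊎ s ≡ + 1 ⟨mod + 4 ⟩ →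
          r ≡ + 1 ⟨mod + 4 ⟩ ⊎ r ≡ + 2 ⟨mod + 4 ⟩ → ¬ (s + r ≡ + 0 ⟨mod + 4 ⟩)
  s+r≢0 (inj₁ s≡0) (inj₁ r≡1) = residue≢0 (s<s z<s) ∘ mod-trans (mod-sym (mod-+-cong s≡0 r≡1))
  s+r≢0 (inj₁ s≡0) (inj₂ r≡2) = residue≢0 (s<s (s<s z<s)) ∘ mod-trans (mod-sym (mod-+-cong s≡0 r≡2))
  s+r≢0 (inj₂ s≡1) (inj₁ r≡1) = residue≢0 (s<s (s<s z<s)) ∘ mod-trans (mod-sym (mod-+-cong s≡1 r≡1))
  s+r≢0 (inj₂ s≡1) (inj₂ r≡2) =
    residue≢0 (s<s (s<s (s<s z<s))) ∘ mod-trans (mod-sym (mod-+-cong s≡1 r≡2))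

Criterion : ℤ → ℤ → Set
Criterion D V =
  (D ≡ + 0 ⟨mod + 4 ⟩ × V ≡ + 0 ⟨mod + 2 ⟩)
  ⊎ (¬ (D ≡ + 0 ⟨mod + 4 ⟩)
     × (V ≡ + 0 ⟨mod + 4 ⟩ ⊎ ((V ≡ + 0 ⟨mod + 2 ⟩ × ¬ (V ≡ + 0 ⟨mod + 4 ⟩)) × D ≡ + 7 ⟨mod + 8 ⟩)))

∣-criterion⇔Criterion : ∀ D V →
  ((+ 4 ∣ D × + 2 ∣ V) ⊎ (¬ (+ 4 ∣ D) × (+ 4 ∣ V ⊎ (+ 2 ∥ V × D ≡ + 7 [mod + 8 ]))))
  ⇔ Criterion D V
∣-criterion⇔Criterion D V =
  (∣⇔≡0 (+ 4) D ×-⇔ ∣⇔≡0 (+ 2) V)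
  ⊎-⇔ (¬-cong-⇔ (∣⇔≡0 (+ 4) D)
       ×-⇔ (∣⇔≡0 (+ 4) V
            ⊎-⇔ ((∣⇔≡0 (+ 2) V ×-⇔ ¬-cong-⇔ (∣⇔≡0 (+ 4) V)) ×-⇔ [mod]⇔⟨mod⟩ (+ 8) D (+ 7))))

odd≢0-mod-4 : ∀ d → ¬ (+ 2 * d + + 1 ≡ + 0 ⟨mod + 4 ⟩)
odd≢0-mod-4 d = odd≢0 d ∘ mod-weaken 2∣4

¬Criterion-odd-V : ∀ D j → ¬ Criterion D (+ 2 * j + + 1)
¬Criterion-odd-V D j (inj₁ (_ , V≡0))                    = odd≢0 j V≡0
¬Criterion-odd-V D j (inj₂ (_ , inj₁ V≡0))               = odd≢0 j (mod-weaken 2∣4 V≡0)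
¬Criterion-odd-V D j (inj₂ (_ , inj₂ ((V≡0 , _) , _)))   = odd≢0 j V≡0

Criterion-4m-even-V : ∀ m j → Criterion (+ 4 * m) (+ 2 * j)
Criterion-4m-even-V m j = inj₁ (multiple≡0 (+ 4) m , multiple≡0 (+ 2) j)

Criterion-odd-D-4∣V : ∀ d i → Criterion (+ 2 * d + + 1) (+ 2 * (+ 2 * i))
Criterion-odd-D-4∣V d i = inj₂ (odd≢0-mod-4 d , inj₁ (by-quotient i (solve (i ∷ []))))

Criterion-odd-D-2∥V⇔ : ∀ d i →
  Criterion (+ 2 * d + + 1) (+ 2 * (+ 2 * i + + 1)) ⇔ (+ 2 * d + + 1 ≡ + 7 ⟨mod + 8 ⟩)
Criterion-odd-D-2∥V⇔ d i =
  mk⇔ to (λ D≡7 → inj₂ (odd≢0-mod-4 d , inj₂ ((multiple≡0 (+ 2) _ , V≢0) , D≡7)))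
  where
  V≢0 : ¬ (+ 2 * (+ 2 * i + + 1) ≡ + 0 ⟨mod + 4 ⟩)
  V≢0 V≡0 = residue≢0 (s<s (s<s z<s)) (begin
    + 2                        ≈⟨ by-quotient i (solve (i ∷ [])) ⟨
    + 2 * (+ 2 * i + + 1)      ≈⟨ V≡0 ⟩
    + 0                        ∎)
    where open ≡-mod-Reasoning (+ 4)
  to : Criterion (+ 2 * d + + 1) (+ 2 * (+ 2 * i + + 1)) → + 2 * d + + 1 ≡ + 7 ⟨mod + 8 ⟩
  to (inj₁ (D≡0 , _))              = ⊥-elim (odd≢0-mod-4 d D≡0)
  to (inj₂ (_ , inj₁ V≡0))         = ⊥-elim (V≢0 V≡0)
  to (inj₂ (_ , inj₂ (_ , D≡7)))   = D≡7

z²+Dj²⇔Criterion : ∀ d j →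
  RootMod (+ 8) (λ z → z * z + (+ 2 * d + + 1) * (j * j)) ⇔ Criterion (+ 2 * d + + 1) (+ 2 * j)
z²+Dj²⇔Criterion d = by-parity
  (λ i → mk⇔ (const (Criterion-odd-D-4∣V d i)) (const (z²+E[2W]²-root (+ 2 * d + + 1) i)))
  (λ i → ⇔-sym (Criterion-odd-D-2∥V⇔ d i) ⇔-∘ z²+Dw²-root⇔ (odd≡1 d) i)

z²+mV²⇔Criterion : ∀ {m} → m ≡ + 1 ⟨mod + 4 ⟩ ⊎ m ≡ + 2 ⟨mod + 4 ⟩ →
  ∀ V → RootMod (+ 8) (λ z → z * z + m * (V * V)) ⇔ Criterion (+ 4 * m) V
z²+mV²⇔Criterion {m} m≡1∨2 = by-parity
  (λ j → mk⇔ (const (Criterion-4m-even-V m j)) (const (z²+E[2W]²-root m j)))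
  (λ j → mk⇔ (⊥-elim ∘ z²+mw²-no-root m≡1∨2 j) (⊥-elim ∘ ¬Criterion-odd-V (+ 4 * m) j))

data DiscriminantShape : ℤ → Set where
  odd        : ∀ d → DiscriminantShape (+ 2 * d + + 1)
  four-times : ∀ m → m ≡ + 1 ⟨mod + 4 ⟩ ⊎ m ≡ + 2 ⟨mod + 4 ⟩ → DiscriminantShape (+ 4 * m)

fundamental⇒shape : ∀ D → FundamentalDiscriminant (- D) → DiscriminantShape D
fundamental⇒shape D (inj₁ (-D≡1 , _)) = odd-shape D -D≡1
  where
  odd-shape : ∀ D → - D ≡ + 1 [mod + 4 ] → DiscriminantShape D
  odd-shape = by-parity
    (λ k -2k≡1 → ⊥-elim (residue≢0 (s<s z<s) (begin
      + 1           ≈⟨ mod-weaken 2∣4 (Equivalence.to ([mod]⇔⟨mod⟩ (+ 4) (- (+ 2 * k)) (+ 1)) -2k≡1)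
                     ⟨
      - (+ 2 * k)   ≡⟨ ℤ.neg-distribʳ-* (+ 2) k ⟩
      + 2 * - k     ≈⟨ multiple≡0 (+ 2) (- k) ⟩
      + 0           ∎)))
    (λ d _ → odd d)
    where open ≡-mod-Reasoning (+ 2)
fundamental⇒shape D (inj₂ (m , -D≡4m , m≡2∨3 , _)) =
  subst DiscriminantShape 4[-m]≡D (four-times (- m) (-m≡1∨2 m≡2∨3))
  where
  4[-m]≡D : + 4 * - m ≡ D
  4[-m]≡D = begin
    + 4 * - m     ≡⟨ ℤ.neg-distribʳ-* (+ 4) m ⟨
    - (+ 4 * m)   ≡⟨ cong -_ -D≡4m ⟨
    - - D         ≡⟨ ℤ.neg-involutive D ⟩
    D             ∎
    where open ≡-Reasoning
  -m≡1∨2 : m ≡ + 2 [mod + 4 ] ⊎ m ≡ + 3 [mod + 4 ] → - m ≡ + 1 ⟨mod + 4 ⟩ ⊎ - m ≡ + 2 ⟨mod + 4 ⟩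
  -m≡1∨2 (inj₁ m≡2) = inj₂
    (mod-trans (mod-neg-cong (Equivalence.to ([mod]⇔⟨mod⟩ (+ 4) m (+ 2)) m≡2))
               (by-quotient (- + 1) refl))
  -m≡1∨2 (inj₂ m≡3) = inj₁
    (mod-trans (mod-neg-cong (Equivalence.to ([mod]⇔⟨mod⟩ (+ 4) m (+ 3)) m≡3))
               (by-quotient (- + 1) refl))

RootMod-χ⇔Criterion : ∀ {D p} → DiscriminantShape D → p ≡ + 1 ⟨mod + 2 ⟩ →
  ∀ U V → + 4 * p ≡ U * U + D * (V * V) → RootMod (+ 8) (χ U p) ⇔ Criterion D V
RootMod-χ⇔Criterion {p = p} (odd d) p≡1 U = by-parity V-even V-odd
  where
  V-even : ∀ j → + 4 * p ≡ U * U + (+ 2 * d + + 1) * ((+ 2 * j) * (+ 2 * j)) →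
           RootMod (+ 8) (χ U p) ⇔ Criterion (+ 2 * d + + 1) (+ 2 * j)
  V-even j 4p≡ =
    z²+Dj²⇔Criterion d j ⇔-∘ RootMod-χ⇔z²+N U p N (trans 4p≡ (cong (λ t → U * U + t) DV²≡4N))
    where
    N : ℤ
    N = (+ 2 * d + + 1) * (j * j)
    DV²≡4N : (+ 2 * d + + 1) * ((+ 2 * j) * (+ 2 * j)) ≡ + 4 * ((+ 2 * d + + 1) * (j * j))
    DV²≡4N = solve (d ∷ j ∷ [])
  V-odd : ∀ j → + 4 * p ≡ U * U + (+ 2 * d + + 1) * ((+ 2 * j + + 1) * (+ 2 * j + + 1)) →
          RootMod (+ 8) (χ U p) ⇔ Criterion (+ 2 * d + + 1) (+ 2 * j + + 1)
  V-odd j 4p≡ = mk⇔ (⊥-elim ∘ no-RootMod-χ p≡1 DV²≡1 U 4p≡) (⊥-elim ∘ ¬Criterion-odd-V _ j)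
    where
    DV²≡1 : (+ 2 * d + + 1) * ((+ 2 * j + + 1) * (+ 2 * j + + 1)) ≡ + 1 ⟨mod + 2 ⟩
    DV²≡1 = mod-*-cong (odd≡1 d) (mod-*-cong (odd≡1 j) (odd≡1 j))
RootMod-χ⇔Criterion {p = p} (four-times m m≡1∨2) _ U V 4p≡ =
  z²+mV²⇔Criterion m≡1∨2 V ⇔-∘ RootMod-χ⇔z²+N U p (m * (V * V)) 4p≡′
  where
  4p≡′ : + 4 * p ≡ U * U + + 4 * (m * (V * V))
  4p≡′ = trans 4p≡ (cong (λ t → U * U + t) (ℤ.*-assoc (+ 4) m (V * V)))

-- Only the parity of p is used: neither D > 0, nor the primality of p, nor the squarefreeness
-- in the definition of a fundamental discriminant plays a role.
proposition8p4 : (D : ℕ) → D > 0 → FundamentalDiscriminant (- (+ D))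
    → (p : ℕ) → Prime p → ¬ (+ 2 ∣ + p)
    → (U V : ℤ) → + 4 * + p ≡ U * U + + D * (V * V)
    → (∃[ x ] (χ U (+ p) x ≡ + 0 [mod + 8 ]))
      ⇔ ((+ 4 ∣ + D × + 2 ∣ V)
         ⊎ (¬ (+ 4 ∣ + D) × (+ 4 ∣ V ⊎ (+ 2 ∥ V × + D ≡ + 7 [mod + 8 ]))))
proposition8p4 D _ fundamental p _ p-odd U V 4p≡ =
  ⇔-sym (∣-criterion⇔Criterion (+ D) V)
    ⇔-∘ (RootMod-χ⇔Criterion (fundamental⇒shape (+ D) fundamental) (2∤⇒≡1 (+ p) p-odd) U V 4p≡
          ⇔-∘ ∃-root⇔RootMod (+ 8) (χ U (+ p)))
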